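{- Let $X$ be an ordered set containing a locally bounded commutative ordered monoid $M$ with distinguished element $0$ as an almost dense, bicofinal subset, with $0\leq1$ in $M$. Assume the multiplication on $M$ is preadmissible and satisfies condition (*): for all $x,y\in X$, if $c<d$ in $M$, then there are $a,b,a',b'\in M$ such that $a\leq x\leq b$, $a'\leq y\leq b'$, and either $c<\min\{aa',ab',ba',bb'\}$ or $\max\{aa',ab',ba',bb'\}<d$. Then for all $x,y\in X$ the subset $$P_{x,y}=\{\min\{aa',ab',ba',bb'\}: a,b,a',b'\in M,\ a\leq x\leq b,\ a'\leq y\leq b'\}$$ is supable (as a subset of $X$).
   Context: All reasoning is constructive (no law of excluded middle). An ordered set is a set $X$ with a binary relation $<$ satisfying, for all $x,y,z$: asymmetry ($x<y$ implies not $y<x$), cotransitivity ($x<y$ implies $x<z$ or $z<y$), and negative antisymmetry (not $x<y$ and not $y<x$ imply $x=y$). Write $x\leq y$ for "not $y<x$", $x>y$ for $y<x$. A subset $S$ of $X$ (with the induced order) is almost dense if $x<y$ in $X$ implies $x\leq s<s'\leq y$ for some $s,s'\in S$, and bicofinal if for each $x\in X$ there are $s,s'\in S$ with $s\leq x\leq s'$. A subset $S$ of $X$ is upper order located if whenever $x<y$ in $X$, either $x<s$ for some $s\in S$ or $u<y$ for some upper bound $u$ of $S$; it is supable if it is nonempty, bounded above, and upper order located. A set is finitely enumerable if it is empty or the image of $\{1,\dots,n\}$ for some positive integer $n$. A commutative ordered monoid with distinguished element $0$ is an ordered set $M$ with a distinguished element $0$ and a commutative monoid multiplication (identity $1$)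 such that $0<x$ and $0<y$ imply $0<xy$; it is locally bounded if every finitely enumerable subset has a minimum and a maximum element (min and max are taken in $M$). A multiplication on $M$ is preadmissible if for all $x,y,z\in M$: $0x=0=x0$; $x<y$ and $z>0$ imply $xz<yz$; $x<y$ and $z<0$ imply $xz>yz$. -}

module Defs where

open import Data.Nat using (ℕ; suc)
open import Data.Fin using (Fin)
open import Data.Product using (Σ; ∃; _×_; _,_)
open import Data.Sum using (_⊎_)
open import Relation.Nullary using (¬_)
open import Relation.Binary.PropositionalEquality using (_≡_)
open import Function.Definitions using (Injective)
open import Algebra.Structures using (IsCommutativeMonoid)

record IsOrderedSet {X : Set} (_<_ : X → X → Set) : Set where
  field
    asym        : ∀ {x y} → x < y → ¬ (y < x)
    cotrans     : ∀ {x y} z → x < y → (x < z) ⊎ (z < y)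
    negAntisym  : ∀ {x y} → ¬ (x < y) → ¬ (y < x) → x ≡ y

module Order {X : Set} (_<_ : X → X → Set) where

  _≤_ : X → X → Set
  x ≤ y = ¬ (y < x)

  IsUpperBound : (X → Set) → X → Set
  IsUpperBound S u = ∀ s → S s → s ≤ u

  BoundedAbove : (X → Set) → Set
  BoundedAbove S = Σ X λ u → IsUpperBound S u

  Inhabited : (X → Set) → Set
  Inhabited S = Σ X λ s → S s

  UpperOrderLocated : (X → Set) → Set
  UpperOrderLocated S =
    ∀ x y → x < y →
      (Σ X λ s → S s × (x < s)) ⊎ (Σ X λ u → IsUpperBound S u × (u < y))

  Supable : (X → Set) → Set
  Supable S = Inhabited S × BoundedAbove S × UpperOrderLocated S

-- A subset M of X given by an injective map ι : M → X, with the
-- induced order.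

module SubsetOrder {X : Set} (_<_ : X → X → Set) {M : Set} (ι : M → X) where
  open Order _<_

  _<M_ : M → M → Set
  a <M b = ι a < ι b

  _≤M_ : M → M → Set
  a ≤M b = ¬ (b <M a)

  AlmostDense : Set
  AlmostDense = ∀ x y → x < y →
    Σ M λ s → Σ M λ s' → (x ≤ ι s) × (s <M s') × (ι s' ≤ y)

  Bicofinal : Set
  Bicofinal = ∀ x → Σ M λ s → Σ M λ s' → (ι s ≤ x) × (x ≤ ι s')

  IsMinimumOf : ∀ {I : Set} → (I → M) → M → Set
  IsMinimumOf {I} f m = (Σ I λ i → f i ≡ m) × (∀ j → m ≤M f j)

  IsMaximumOf : ∀ {I : Set} → (I → M) → M → Set
  IsMaximumOf {I} f m = (Σ I λ i → f i ≡ m) × (∀ j → f j ≤M m)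

  -- locally bounded: every inhabited finitely enumerable subset
  -- (image of Fin (suc n)) has a minimum and a maximum in M
  LocallyBounded : Set
  LocallyBounded = ∀ n (f : Fin (suc n) → M) →
    (Σ M λ m → IsMinimumOf f m) × (Σ M λ m → IsMaximumOf f m)

  four : M → M → M → M → Fin 4 → M
  four p q r s Fin.zero = p
  four p q r s (Fin.suc Fin.zero) = q
  four p q r s (Fin.suc (Fin.suc Fin.zero)) = r
  four p q r s (Fin.suc (Fin.suc (Fin.suc Fin.zero))) = s

  module Mult (0M : M) (_·_ : M → M → M) where

    OrderedMonoidAxiom : Set
    OrderedMonoidAxiom = ∀ x y → 0M <M x → 0M <M y → 0M <M (x · y)

    Preadmissible : Set
    Preadmissible =
      (∀ x → (0M · x ≡ 0M) × (x · 0M ≡ 0M)) ×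
      (∀ x y z → x <M y → 0M <M z → (x · z) <M (y · z)) ×
      (∀ x y z → x <M y → z <M 0M → (y · z) <M (x · z))

    prods : M → M → M → M → Fin 4 → M
    prods a b a' b' = four (a · a') (a · b') (b · a') (b · b')

    Brackets : X → X → M → M → M → M → Set
    Brackets x y a b a' b' =
      (ι a ≤ x) × (x ≤ ι b) × (ι a' ≤ y) × (y ≤ ι b')

    ConditionStar : Set
    ConditionStar = ∀ x y c d → c <M d →
      Σ M λ a → Σ M λ b → Σ M λ a' → Σ M λ b' →
        Brackets x y a b a' b' ×
        ((Σ M λ m → IsMinimumOf (prods a b a' b') m × (c <M m)) ⊎
         (Σ M λ m → IsMaximumOf (prods a b a' b') m × (m <M d)))

    P : X → X → X → Set
    P x y z = Σ M λ a → Σ M λ b → Σ M λ a' → Σ M λ b' →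
      Brackets x y a b a' b' ×
      (Σ M λ m → IsMinimumOf (prods a b a' b') m × (ι m ≡ z))

-- Any element of P x y is the minimum of the four corner products of a
-- bracket (a ≤ x ≤ b, a' ≤ y ≤ b'), and the maximum corner product of any
-- bracket bounds P x y from above: picking s between both brackets of x
-- and t between both brackets of y, preadmissibility puts s·t between the
-- corners of each bracket, so min ≤ s·t ≤ max.  Such s, t exist only up
-- to double negation, which suffices because ≤ is a negation.
-- Bicofinality and local boundedness then give an element and an upper
-- bound, and almost density together with (*) gives upper order
-- locatedness.
module Submission where

open import Defs
open import Data.Product using (Σ; _×_; _,_; proj₁; proj₂)
open import Data.Sum using (_⊎_; inj₁; inj₂)
open import Data.Fin using (zero; suc)
open import Function.Definitions using (Injective)
open import Algebra.Structures using (IsCommutativeMonoid)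
open import Relation.Nullary using (¬_; yes; no; contradiction)
open import Relation.Nullary.Decidable.Core using (¬¬-excluded-middle)
open import Relation.Binary.PropositionalEquality using (_≡_; refl; sym; trans; cong; subst)

module OrderedSetProperties {X : Set} {_<_ : X → X → Set} (os : IsOrderedSet _<_) where
  open IsOrderedSet os
  open Order _<_

  <-irrefl : ∀ {x} → ¬ (x < x)
  <-irrefl x<x = asym x<x x<x

  ≤-reflexive : ∀ {x y} → x ≡ y → x ≤ y
  ≤-reflexive refl = <-irrefl

  ≤-trans : ∀ {x y z} → x ≤ y → y ≤ z → x ≤ z
  ≤-trans {y = y} x≤y y≤z z<x with cotrans y z<x
  ... | inj₁ z<y = y≤z z<y
  ... | inj₂ y<x = x≤y y<x

  ≤-<-trans : ∀ {x y z} → x ≤ y → y < z → x < z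
  ≤-<-trans {x} x≤y y<z with cotrans x y<z
  ... | inj₁ y<x = contradiction y<x x≤y
  ... | inj₂ x<z = x<z

  <-≤-trans : ∀ {x y z} → x < y → y ≤ z → x < z
  <-≤-trans {z = z} x<y y≤z with cotrans z x<y
  ... | inj₁ x<z = x<z
  ... | inj₂ z<y = contradiction z<y y≤z

  ¬¬-trichotomy : ∀ x y → ¬ ¬ (x < y ⊎ y < x ⊎ x ≡ y)
  ¬¬-trichotomy x y k = ¬¬-excluded-middle λ
    { (yes x<y) → k (inj₁ x<y)
    ; (no x≮y) → ¬¬-excluded-middle λ
        { (yes y<x) → k (inj₂ (inj₁ y<x))
        ; (no y≮x) → k (inj₂ (inj₂ (negAntisym x≮y y≮x))) } }

  <-mono⇒≤-mono : (f : X → X) → (∀ {x y} → x < y → f x < f y) →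
                  ∀ {x y} → x ≤ y → f x ≤ f y
  <-mono⇒≤-mono f mono {x} {y} x≤y fy<fx = ¬¬-excluded-middle λ
    { (yes x<y) → asym (mono x<y) fy<fx
    ; (no x≮y) → <-irrefl (subst (λ z → f y < f z) (negAntisym x≮y x≤y) fy<fx) }

  <-anti⇒≤-anti : (f : X → X) → (∀ {x y} → x < y → f y < f x) →
                  ∀ {x y} → x ≤ y → f y ≤ f x
  <-anti⇒≤-anti f anti {x} {y} x≤y fx<fy = ¬¬-excluded-middle λ
    { (yes x<y) → asym (anti x<y) fx<fy
    ; (no x≮y) → <-irrefl (subst (λ z → f z < f y) (negAntisym x≮y x≤y) fx<fy) }

inducedIsOrderedSet : ∀ {X : Set} {_<_ : X → X → Set} → IsOrderedSet _<_ →
  ∀ {M : Set} {ι : M → X} → Injective _≡_ _≡_ ι → IsOrderedSet (SubsetOrder._<M_ _<_ ι)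
inducedIsOrderedSet os {ι = ι} inj = record
  { asym = asym
  ; cotrans = λ z → cotrans (ι z)
  ; negAntisym = λ a≮b b≮a → inj (negAntisym a≮b b≮a)
  }
  where open IsOrderedSet os

module CornerProducts {X : Set} {_<_ : X → X → Set} (os : IsOrderedSet _<_)
    {M : Set} {ι : M → X} (inj : Injective _≡_ _≡_ ι)
    (0M : M) (_·_ : M → M → M) (·-comm : ∀ a b → a · b ≡ b · a)
    (pre : SubsetOrder.Mult.Preadmissible _<_ ι 0M _·_) where
  open Order _<_
  open SubsetOrder _<_ ι
  open Mult 0M _·_
  open OrderedSetProperties os
  private module OnM = OrderedSetProperties (inducedIsOrderedSet os inj)

  ·-zeroʳ : ∀ a → a · 0M ≡ 0M
  ·-zeroʳ a = proj₂ (proj₁ pre a)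

  ·-monoˡ-< : ∀ {t} → 0M <M t → ∀ {a b} → a <M b → (a · t) <M (b · t)
  ·-monoˡ-< 0<t a<b = proj₁ (proj₂ pre) _ _ _ a<b 0<t

  ·-antiˡ-< : ∀ {t} → t <M 0M → ∀ {a b} → a <M b → (b · t) <M (a · t)
  ·-antiˡ-< t<0 a<b = proj₂ (proj₂ pre) _ _ _ a<b t<0

  Between : M → M → M → Set
  Between p q r = (p ≤M q × q ≤M r) ⊎ (r ≤M q × q ≤M p)

  ·-betweenˡ : ∀ {a s b} t → a ≤M s → s ≤M b → ¬ ¬ Between (a · t) (s · t) (b · t)
  ·-betweenˡ {a} {s} {b} t a≤s s≤b k = OnM.¬¬-trichotomy 0M t λ
    { (inj₁ 0<t) → k (inj₁ (mono 0<t a≤s , mono 0<t s≤b))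
    ; (inj₂ (inj₁ t<0)) → k (inj₂ (anti t<0 s≤b , anti t<0 a≤s))
    ; (inj₂ (inj₂ 0≡t)) → k (inj₁ (annihilated 0≡t a s , annihilated 0≡t s b)) }
    where
    mono : 0M <M t → ∀ {u v} → u ≤M v → (u · t) ≤M (v · t)
    mono 0<t = OnM.<-mono⇒≤-mono (_· t) (·-monoˡ-< 0<t)
    anti : t <M 0M → ∀ {u v} → u ≤M v → (v · t) ≤M (u · t)
    anti t<0 = OnM.<-anti⇒≤-anti (_· t) (·-antiˡ-< t<0)
    annihilated : 0M ≡ t → ∀ u v → (u · t) ≤M (v · t)
    annihilated refl u v = ≤-reflexive (cong ι (trans (·-zeroʳ u) (sym (·-zeroʳ v))))

  ·-betweenʳ : ∀ s {a t b} → a ≤M t → t ≤M b → ¬ ¬ Between (s · a) (s · t) (s · b)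
  ·-betweenʳ s {a} {t} {b} rewrite ·-comm s a | ·-comm s t | ·-comm s b = ·-betweenˡ s

  between-lowerBound : ∀ {p q r w} → ¬ ¬ Between p q r → w ≤M p → w ≤M r → w ≤M q
  between-lowerBound between w≤p w≤r q<w = between λ
    { (inj₁ (p≤q , _)) → ≤-trans w≤p p≤q q<w
    ; (inj₂ (r≤q , _)) → ≤-trans w≤r r≤q q<w }

  between-upperBound : ∀ {p q r w} → ¬ ¬ Between p q r → p ≤M w → r ≤M w → q ≤M w
  between-upperBound between p≤w r≤w w<q = between λ
    { (inj₁ (_ , q≤r)) → ≤-trans q≤r r≤w w<q
    ; (inj₂ (_ , q≤p)) → ≤-trans q≤p p≤w w<q }

  corners-lowerBound : ∀ {a b a' b' s t m} → a ≤M s → s ≤M b → a' ≤M t → t ≤M b' →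
    (∀ j → m ≤M prods a b a' b' j) → m ≤M (s · t)
  corners-lowerBound {a} {b} {t = t} a≤s s≤b a'≤t t≤b' m≤ =
    between-lowerBound (·-betweenˡ t a≤s s≤b)
      (between-lowerBound (·-betweenʳ a a'≤t t≤b') (m≤ zero) (m≤ (suc zero)))
      (between-lowerBound (·-betweenʳ b a'≤t t≤b') (m≤ (suc (suc zero))) (m≤ (suc (suc (suc zero)))))

  corners-upperBound : ∀ {a b a' b' s t m} → a ≤M s → s ≤M b → a' ≤M t → t ≤M b' →
    (∀ j → prods a b a' b' j ≤M m) → (s · t) ≤M m
  corners-upperBound {a} {b} {t = t} a≤s s≤b a'≤t t≤b' ≤m =
    between-upperBound (·-betweenˡ t a≤s s≤b)
      (between-upperBound (·-betweenʳ a a'≤t t≤b') (≤m zero) (≤m (suc zero)))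
      (between-upperBound (·-betweenʳ b a'≤t t≤b') (≤m (suc (suc zero))) (≤m (suc (suc (suc zero)))))

  ¬¬-commonPoint : ∀ {x a b e f} → ι a ≤ x → x ≤ ι b → ι e ≤ x → x ≤ ι f →
    ¬ ¬ (Σ M λ s → a ≤M s × s ≤M b × e ≤M s × s ≤M f)
  ¬¬-commonPoint {a = a} {e = e} a≤x x≤b e≤x x≤f k = ¬¬-excluded-middle λ
    { (yes e<a) → k (a , <-irrefl , ≤-trans a≤x x≤b , asym e<a , ≤-trans a≤x x≤f)
    ; (no e≮a) → k (e , e≮a , ≤-trans e≤x x≤b , <-irrefl , ≤-trans e≤x x≤f) }
    where open IsOrderedSet os using (asym)

  min≤max : ∀ {x y a b a' b' e f e' f' m n} →
    Brackets x y e f e' f' → Brackets x y a b a' b' →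
    (∀ j → m ≤M prods e f e' f' j) → (∀ j → prods a b a' b' j ≤M n) → m ≤M n
  min≤max (e≤x , x≤f , e'≤y , y≤f') (a≤x , x≤b , a'≤y , y≤b') m≤ ≤n n<m =
    ¬¬-commonPoint a≤x x≤b e≤x x≤f λ { (s , a≤s , s≤b , e≤s , s≤f) →
    ¬¬-commonPoint a'≤y y≤b' e'≤y y≤f' λ { (t , a'≤t , t≤b' , e'≤t , t≤f') →
      ≤-trans (corners-lowerBound e≤s s≤f e'≤t t≤f' m≤)
              (corners-upperBound a≤s s≤b a'≤t t≤b' ≤n) n<m } }

  P-upperBound : ∀ {x y a b a' b' n} → Brackets x y a b a' b' →
    (∀ j → prods a b a' b' j ≤M n) → IsUpperBound (P x y) (ι n)
  P-upperBound br ≤n z (_ , _ , _ , _ , br′ , m , (_ , m≤) , ιm≡z) =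
    subst (_≤ ι _) ιm≡z (min≤max br′ br m≤ ≤n)

  bracketing : Bicofinal → ∀ x y →
    Σ M λ a → Σ M λ b → Σ M λ a' → Σ M λ b' → Brackets x y a b a' b'
  bracketing bicofinal x y
    with bicofinal x | bicofinal y
  ... | a , b , a≤x , x≤b | a' , b' , a'≤y , y≤b' = a , b , a' , b' , (a≤x , x≤b , a'≤y , y≤b')

  P-inhabited : LocallyBounded → ∀ {x y a b a' b'} → Brackets x y a b a' b' → Inhabited (P x y)
  P-inhabited lb {a = a} {b} {a'} {b'} br
    with proj₁ (lb 3 (prods a b a' b'))
  ... | m , isMin = ι m , a , b , a' , b' , br , m , isMin , refl

  P-boundedAbove : LocallyBounded → ∀ {x y a b a' b'} → Brackets x y a b a' b' → BoundedAbove (P x y)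
  P-boundedAbove lb {a = a} {b} {a'} {b'} br
    with proj₂ (lb 3 (prods a b a' b'))
  ... | n , _ , ≤n = ι n , P-upperBound br ≤n

  P-upperOrderLocated : AlmostDense → ConditionStar → ∀ x y → UpperOrderLocated (P x y)
  P-upperOrderLocated almostDense star x y p q p<q
    with almostDense p q p<q
  ... | c , d , p≤c , c<d , d≤q
    with star x y c d c<d
  ... | a , b , a' , b' , br , inj₁ (m , isMin , c<m) =
    inj₁ (ι m , (a , b , a' , b' , br , m , isMin , refl) , ≤-<-trans p≤c c<m)
  ... | _ , _ , _ , _ , br , inj₂ (n , (_ , ≤n) , n<d) =
    inj₂ (ι n , P-upperBound br ≤n , <-≤-trans n<d d≤q)

theorem13 : (X : Set) (_<_ : X → X → Set) → IsOrderedSet _<_ →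
    (M : Set) (ι : M → X) → Injective _≡_ _≡_ ι →
    (0M 1M : M) (_·_ : M → M → M) → IsCommutativeMonoid _≡_ _·_ 1M →
    SubsetOrder.Mult.OrderedMonoidAxiom _<_ ι 0M _·_ →
    SubsetOrder.LocallyBounded _<_ ι →
    SubsetOrder.AlmostDense _<_ ι →
    SubsetOrder.Bicofinal _<_ ι →
    SubsetOrder._≤M_ _<_ ι 0M 1M →
    SubsetOrder.Mult.Preadmissible _<_ ι 0M _·_ →
    SubsetOrder.Mult.ConditionStar _<_ ι 0M _·_ →
    ∀ x y → Order.Supable _<_ (SubsetOrder.Mult.P _<_ ι 0M _·_ x y)
theorem13 X _<_ os M ι inj 0M 1M _·_ isCommMonoid _
          locallyBounded almostDense bicofinal _ pre star x y =
  let open CornerProducts os inj 0M _·_ (IsCommutativeMonoid.comm isCommMonoid) pre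
      (_ , _ , _ , _ , br) = bracketing bicofinal x y
  in P-inhabited locallyBounded br , P-boundedAbove locallyBounded br ,
     P-upperOrderLocated almostDense star x y
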